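{- Let $\tau=123$. For all $k\ge 2$, \[ F_\tau(x,y;k)=\frac{1}{1-kx-\sum_{j=3}^{k}(-x)^j\binom{k}{j}(1-y)^{\lfloor j/2\rfloor}U_{j-3}(y)}, \] where the polynomials $U_n(y)$ are defined by $U_0(y)=U_1(y)=1$, $U_{2n}(y)=(1-y)U_{2n-1}(y)-U_{2n-2}(y)$ and $U_{2n+1}(y)=U_{2n}(y)-U_{2n-1}(y)$ for $n\ge1$. Furthermore, \[ \sum_{n\ge0}U_n(y)z^n=\frac{1+z+z^2}{1+(1+y)z^2+z^4}. \]
   Context: $[k]^n$ is the set of words of length $n$ over $\{1,\dots,k\}$. An occurrence of the subword pattern $123$ in $\sigma=\sigma_1\cdots\sigma_n$ is an index $i$ with $\sigma_i<\sigma_{i+1}<\sigma_{i+2}$. $\sigma(123)$ is the number of occurrences, and $F_{123}(x,y;k)=\sum_{n\ge0}\sum_{\sigma\in[k]^n}x^ny^{\sigma(123)}$. -}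

module Defs where

open import Data.Nat as ℕ using (ℕ; zero; suc; _∸_; _≤ᵇ_; _<ᵇ_)
open import Data.Nat.Combinatorics using (_C_)
open import Data.Integer using (ℤ; +_; -_; _+_; _-_; _*_)
open import Data.Bool using (Bool; true; false; not; if_then_else_; _∧_)
open import Data.Fin using (Fin; toℕ)
open import Data.Vec using (Vec; []; _∷_)
open import Data.List using (List; []; _∷_; map; concatMap; filterᵇ; length)
open import Data.List using () renaming (_∷_ to _∷ₗ_)

-- Words over [k] = Fin k (letter i ∈ Fin k stands for i+1)

allWords : (k n : ℕ) → List (Vec (Fin k) n)
allWords k zero    = [] ∷ₗ []
allWords k (suc n) =
  concatMap (λ a → map (a ∷_) (allWords k n)) (Data.List.allFin k)

occ123 : {k n : ℕ} → Vec (Fin k) n → ℕ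
occ123 (a ∷ rest@(b ∷ c ∷ _)) =
  (if (toℕ a <ᵇ toℕ b) ∧ (toℕ b <ᵇ toℕ c) then 1 else 0) ℕ.+ occ123 rest
occ123 _ = 0

-- Formal series: a bivariate coefficient array  c n m = [x^n y^m]
-- (power series in x whose coefficients are polynomials in y over ℤ),
-- and univariate coefficient arrays for polynomials in y.

Coef : Set
Coef = ℕ → ℤ

Coef2 : Set
Coef2 = ℕ → ℕ → ℤ

sumTo : ℕ → (ℕ → ℤ) → ℤ
sumTo zero    f = f 0
sumTo (suc n) f = sumTo n f + f (suc n)

mulP : Coef → Coef → Coef
mulP p q m = sumTo m (λ i → p i * q (m ∸ i))

mul2 : Coef2 → Coef2 → Coef2
mul2 P Q n m = sumTo n (λ j → sumTo m (λ i → P j i * Q (n ∸ j) (m ∸ i)))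

zeroP : Coef
zeroP _ = + 0

oneP : Coef
oneP zero    = + 1
oneP (suc _) = + 0

oneMinusY : Coef
oneMinusY zero          = + 1
oneMinusY (suc zero)    = - (+ 1)
oneMinusY (suc (suc _)) = + 0

onePlusY : Coef
onePlusY zero          = + 1
onePlusY (suc zero)    = + 1
onePlusY (suc (suc _)) = + 0

subP : Coef → Coef → Coef
subP p q m = p m - q m

scaleP : ℤ → Coef → Coef
scaleP c p m = c * p m

powP : Coef → ℕ → Coef
powP p zero    = oneP
powP p (suc e) = mulP p (powP p e)

isEven : ℕ → Bool
isEven zero    = true
isEven (suc n) = not (isEven n)

signPow : ℕ → ℤ
signPow zero    = + 1
signPow (suc j) = - (signPow j)

half : ℕ → ℕ
half zero          = 0
half (suc zero)    = 0
half (suc (suc n)) = suc (half n)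

U : ℕ → Coef
U zero          = oneP
U (suc zero)    = oneP
U (suc (suc n)) =
  if isEven n   -- i.e. n+2 is even
  then subP (mulP oneMinusY (U (suc n))) (U n)
  else subP (U (suc n)) (U n)

F123 : ℕ → Coef2
F123 k n m = + length (filterᵇ (λ w → occ123 w ℕ.≡ᵇ m) (allWords k n))

-- The denominator  1 - k x - Σ_{j=3}^{k} (-x)^j C(k,j) (1-y)^{⌊j/2⌋} U_{j-3}(y)
denom : ℕ → Coef2
denom k zero                = oneP
denom k (suc zero)          = scaleP (- (+ k)) oneP
denom k (suc (suc zero))    = zeroP
denom k (suc (suc (suc i))) =
  if (3 ℕ.+ i) ≤ᵇ k
  then scaleP (- (signPow (3 ℕ.+ i) * + (k C (3 ℕ.+ i))))
              (mulP (powP oneMinusY (half (3 ℕ.+ i))) (U i))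
  else zeroP

one2 : Coef2
one2 zero    = oneP
one2 (suc _) = zeroP

-- Σ_n U_n(y) z^n as a bivariate array ([z^n y^m])
Useries : Coef2
Useries n = U n

Udenom : Coef2
Udenom zero                            = oneP
Udenom (suc (suc zero))                = onePlusY
Udenom (suc (suc (suc (suc zero))))    = oneP
Udenom _                               = zeroP

Unum : Coef2
Unum zero                = oneP
Unum (suc zero)          = oneP
Unum (suc (suc zero))    = oneP
Unum _                   = zeroP

-- Weight a factorisation of a word into strictly ascending blocks by the product of the weights
-- g_j = blockWeight j of its block lengths.  These satisfy g_1 = 1, g_2 = 0 and
-- g_(t+3) = -(1-y)(g_(t+2) + g_(t+1)), which makes the factorisations of an ascending run of length r
-- weigh y^(r-2) in total; hence all factorisations of a word w together weigh y^(occ123 w).  Splitting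
-- off the first block, an ascending word of length j chosen in C(k,j) ways, gives
-- F_n = Σ_j C(k,j) g_j F_(n-j), i.e. F_123 · (1 - Σ_j C(k,j) g_j x^j) = 1, and -C(k,j) g_j is exactly
-- the x^j coefficient of denom k.  The series Σ U_n z^n follows from U_(n+4) + (1+y) U_(n+2) + U_n = 0.

module Submission where

open import Defs
open import Data.Nat using (ℕ; _≤_)
open import Data.Product using (_×_)
open import Relation.Binary.PropositionalEquality using (_≡_)

import Data.Integer.Properties as ℤₚ
import Data.Nat.Properties as ℕₚ
open import Algebra.Properties.CommutativeSemigroup ℤₚ.+-commutativeSemigroup using (interchange)
open import Algebra.Properties.CommutativeSemigroup ℤₚ.*-commutativeSemigroup using (x∙yz≈y∙xz)
open import Data.Bool using (Bool; true; false; T; not; if_then_else_; _∧_)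
open import Data.Fin as Fin using (Fin; toℕ)
open import Data.Integer using (ℤ; +_; -_; _+_; _-_; _*_)
open import Data.Integer.Tactic.RingSolver using (solve-∀)
open import Data.List using (List; []; _∷_; map; concatMap; filterᵇ; length; _++_; allFin; tabulate)
open import Data.Nat as ℕ using (zero; suc; _∸_; z≤n; _<ᵇ_; _≤ᵇ_; _≡ᵇ_)
open import Data.Nat.Combinatorics using (_C_; nCk+nC[k+1]≡[n+1]C[k+1]; nC1≡n; k>n⇒nCk≡0)
open import Data.Product using (_,_)
open import Data.Vec as Vec using (Vec; []; _∷_)
open import Function using (_∘_)
open import Relation.Binary.PropositionalEquality
  using (_≗_; refl; sym; trans; cong; cong₂; subst; module ≡-Reasoning)

open ≡-Reasoning

-- Finite sums

sumTo-cong≤ : ∀ n {f g : ℕ → ℤ} → (∀ i → i ≤ n → f i ≡ g i) → sumTo n f ≡ sumTo n g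
sumTo-cong≤ zero    f≡g = f≡g 0 z≤n
sumTo-cong≤ (suc n) f≡g =
  cong₂ _+_ (sumTo-cong≤ n (λ i i≤n → f≡g i (ℕₚ.m≤n⇒m≤1+n i≤n))) (f≡g (suc n) ℕₚ.≤-refl)

sumTo-cong : ∀ n {f g : ℕ → ℤ} → f ≗ g → sumTo n f ≡ sumTo n g
sumTo-cong n f≗g = sumTo-cong≤ n (λ i _ → f≗g i)

sumTo-zero : ∀ n (f : ℕ → ℤ) → (∀ i → i ≤ n → f i ≡ + 0) → sumTo n f ≡ + 0
sumTo-zero zero    f f≡0 = f≡0 0 z≤n
sumTo-zero (suc n) f f≡0 =
  cong₂ _+_ (sumTo-zero n f (λ i i≤n → f≡0 i (ℕₚ.m≤n⇒m≤1+n i≤n))) (f≡0 (suc n) ℕₚ.≤-refl)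

sumTo-suc : ∀ n f → sumTo (suc n) f ≡ f 0 + sumTo n (f ∘ suc)
sumTo-suc zero    f = refl
sumTo-suc (suc n) f = trans (cong (λ s → s + f (2 ℕ.+ n)) (sumTo-suc n f)) (ℤₚ.+-assoc (f 0) _ _)

sumTo-distrib-+ : ∀ n f g → sumTo n (λ i → f i + g i) ≡ sumTo n f + sumTo n g
sumTo-distrib-+ zero    f g = refl
sumTo-distrib-+ (suc n) f g =
  trans (cong (λ s → s + (f (suc n) + g (suc n))) (sumTo-distrib-+ n f g))
        (interchange (sumTo n f) (sumTo n g) (f (suc n)) (g (suc n)))

sumTo-scale : ∀ n c f → sumTo n (λ i → c * f i) ≡ c * sumTo n f
sumTo-scale zero    c f = refl
sumTo-scale (suc n) c f =
  trans (cong (λ s → s + c * f (suc n)) (sumTo-scale n c f)) (sym (ℤₚ.*-distribˡ-+ c _ _))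

sumTo-neg : ∀ n f → sumTo n (λ i → - f i) ≡ - sumTo n f
sumTo-neg zero    f = refl
sumTo-neg (suc n) f =
  trans (cong (λ s → s + - f (suc n)) (sumTo-neg n f)) (sym (ℤₚ.neg-distrib-+ (sumTo n f) _))

sumTo-reverse : ∀ n f → sumTo n f ≡ sumTo n (λ i → f (n ∸ i))
sumTo-reverse zero    f = refl
sumTo-reverse (suc n) f = begin
  sumTo n f + f (suc n)                      ≡⟨ cong (λ s → s + f (suc n)) (sumTo-reverse n f) ⟩
  sumTo n (λ i → f (n ∸ i)) + f (suc n)      ≡⟨ ℤₚ.+-comm _ (f (suc n)) ⟩
  f (suc n) + sumTo n (λ i → f (n ∸ i))      ≡⟨ sym (sumTo-suc n (λ i → f (suc n ∸ i))) ⟩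
  sumTo (suc n) (λ i → f (suc n ∸ i))        ∎

-- Polynomials in y

addP : Coef → Coef → Coef
addP p q m = p m + q m

negP : Coef → Coef
negP p m = - p m

mulY : Coef → Coef
mulY p zero    = + 0
mulY p (suc m) = p m

y^ : ℕ → Coef
y^ zero    = oneP
y^ (suc a) = mulY (y^ a)

mulOneMinusY : Coef → Coef
mulOneMinusY p = subP p (mulY p)

y^-coefficient : ∀ a m → (y^ a) m ≡ (if a ≡ᵇ m then + 1 else + 0)
y^-coefficient zero    zero    = refl
y^-coefficient zero    (suc m) = refl
y^-coefficient (suc a) zero    = refl
y^-coefficient (suc a) (suc m) = y^-coefficient a m

mulY-cong : ∀ {p q} → p ≗ q → mulY p ≗ mulY q
mulY-cong p≗q zero    = refl
mulY-cong p≗q (suc m) = p≗q m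

mulY-subP : ∀ p q → mulY (subP p q) ≗ subP (mulY p) (mulY q)
mulY-subP p q zero    = refl
mulY-subP p q (suc m) = refl

mulY-addP : ∀ p q → mulY (addP p q) ≗ addP (mulY p) (mulY q)
mulY-addP p q zero    = refl
mulY-addP p q (suc m) = refl

mulOneMinusY-cong : ∀ {p q} → p ≗ q → mulOneMinusY p ≗ mulOneMinusY q
mulOneMinusY-cong p≗q m = cong₂ _-_ (p≗q m) (mulY-cong p≗q m)

mulOneMinusY-subP : ∀ p q → mulOneMinusY (subP p q) ≗ subP (mulOneMinusY p) (mulOneMinusY q)
mulOneMinusY-subP p q m =
  trans (cong (λ t → subP p q m - t) (mulY-subP p q m)) (shuffle (p m) (q m) (mulY p m) (mulY q m))
  where
  shuffle : ∀ a b c d → a - b - (c - d) ≡ (a - c) - (b - d)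
  shuffle = solve-∀

mulOneMinusY-negP : ∀ p → mulOneMinusY (negP p) ≗ negP (mulOneMinusY p)
mulOneMinusY-negP p zero    = trans (ℤₚ.+-identityʳ (- p 0)) (cong -_ (sym (ℤₚ.+-identityʳ (p 0))))
mulOneMinusY-negP p (suc m) = sym (ℤₚ.neg-distrib-+ (p (suc m)) (- p m))

mulP-cong : ∀ {p p′ q q′} → p ≗ p′ → q ≗ q′ → mulP p q ≗ mulP p′ q′
mulP-cong p≗p′ q≗q′ m = sumTo-cong m (λ i → cong₂ _*_ (p≗p′ i) (q≗q′ (m ∸ i)))

mulP-congˡ : ∀ {p p′} q → p ≗ p′ → mulP p q ≗ mulP p′ q
mulP-congˡ q p≗p′ = mulP-cong {q = q} p≗p′ (λ _ → refl)

mulP-congʳ : ∀ p {q q′} → q ≗ q′ → mulP p q ≗ mulP p q′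
mulP-congʳ p q≗q′ = mulP-cong {p = p} (λ _ → refl) q≗q′

mulP-zeroˡ : ∀ q → mulP zeroP q ≗ zeroP
mulP-zeroˡ q m = sumTo-zero m _ (λ _ _ → refl)

mulP-zeroʳ : ∀ p → mulP p zeroP ≗ zeroP
mulP-zeroʳ p m = sumTo-zero m _ (λ i _ → ℤₚ.*-zeroʳ (p i))

mulP-identityˡ : ∀ q → mulP oneP q ≗ q
mulP-identityˡ q zero    = ℤₚ.*-identityˡ (q 0)
mulP-identityˡ q (suc m) = begin
  sumTo (suc m) (λ i → oneP i * q (suc m ∸ i))
    ≡⟨ sumTo-suc m (λ i → oneP i * q (suc m ∸ i)) ⟩
  + 1 * q (suc m) + sumTo m (λ i → + 0 * q (m ∸ i))
    ≡⟨ cong₂ _+_ (ℤₚ.*-identityˡ (q (suc m))) (sumTo-zero m (λ i → + 0 * q (m ∸ i)) (λ _ _ → refl)) ⟩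
  q (suc m) + + 0
    ≡⟨ ℤₚ.+-identityʳ (q (suc m)) ⟩
  q (suc m) ∎

mulP-identityʳ : ∀ p → mulP p oneP ≗ p
mulP-identityʳ p zero    = ℤₚ.*-identityʳ (p 0)
mulP-identityʳ p (suc m) = begin
  sumTo m (λ i → p i * oneP (suc m ∸ i)) + p (suc m) * oneP (m ∸ m)
    ≡⟨ cong₂ _+_ (sumTo-zero m (λ i → p i * oneP (suc m ∸ i)) (λ i i≤m →
                   trans (cong (λ t → p i * oneP t) (ℕₚ.+-∸-assoc 1 i≤m)) (ℤₚ.*-zeroʳ (p i))))
                 (cong (λ t → p (suc m) * oneP t) (ℕₚ.n∸n≡0 m)) ⟩
  + 0 + p (suc m) * + 1
    ≡⟨ trans (ℤₚ.+-identityˡ _) (ℤₚ.*-identityʳ _) ⟩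
  p (suc m) ∎

mulP-mulYˡ : ∀ p q → mulP (mulY p) q ≗ mulY (mulP p q)
mulP-mulYˡ p q zero    = refl
mulP-mulYˡ p q (suc m) = trans (sumTo-suc m (λ i → mulY p i * q (suc m ∸ i))) (ℤₚ.+-identityˡ _)

mulP-mulYʳ : ∀ p q → mulP p (mulY q) ≗ mulY (mulP p q)
mulP-mulYʳ p q zero    = ℤₚ.*-zeroʳ (p 0)
mulP-mulYʳ p q (suc m) = begin
  sumTo m (λ i → p i * mulY q (suc m ∸ i)) + p (suc m) * mulY q (m ∸ m)
    ≡⟨ cong₂ _+_ (sumTo-cong≤ m (λ i i≤m → cong (λ t → p i * mulY q t) (ℕₚ.+-∸-assoc 1 i≤m)))
                 (cong (λ t → p (suc m) * mulY q t) (ℕₚ.n∸n≡0 m)) ⟩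
  mulP p q m + p (suc m) * + 0
    ≡⟨ trans (cong (λ t → mulP p q m + t) (ℤₚ.*-zeroʳ (p (suc m)))) (ℤₚ.+-identityʳ _) ⟩
  mulP p q m ∎

mulP-distribʳ-addP : ∀ p q r → mulP (addP p q) r ≗ addP (mulP p r) (mulP q r)
mulP-distribʳ-addP p q r m =
  trans (sumTo-cong m (λ i → ℤₚ.*-distribʳ-+ (r (m ∸ i)) (p i) (q i))) (sumTo-distrib-+ m _ _)

mulP-distribˡ-addP : ∀ p q r → mulP p (addP q r) ≗ addP (mulP p q) (mulP p r)
mulP-distribˡ-addP p q r m =
  trans (sumTo-cong m (λ i → ℤₚ.*-distribˡ-+ (p i) (q (m ∸ i)) (r (m ∸ i)))) (sumTo-distrib-+ m _ _)

mulP-negʳ : ∀ p q → mulP p (negP q) ≗ negP (mulP p q)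
mulP-negʳ p q m =
  trans (sumTo-cong m (λ i → sym (ℤₚ.neg-distribʳ-* (p i) (q (m ∸ i))))) (sumTo-neg m _)

mulP-negˡ : ∀ p q → mulP (negP p) q ≗ negP (mulP p q)
mulP-negˡ p q m =
  trans (sumTo-cong m (λ i → sym (ℤₚ.neg-distribˡ-* (p i) (q (m ∸ i))))) (sumTo-neg m _)

mulP-distribʳ-subP : ∀ p q r → mulP (subP p q) r ≗ subP (mulP p r) (mulP q r)
mulP-distribʳ-subP p q r m =
  trans (mulP-distribʳ-addP p (negP q) r m) (cong (λ t → mulP p r m + t) (mulP-negˡ q r m))

mulP-distribˡ-subP : ∀ p q r → mulP p (subP q r) ≗ subP (mulP p q) (mulP p r)
mulP-distribˡ-subP p q r m =
  trans (mulP-distribˡ-addP p q (negP r) m) (cong (λ t → mulP p q m + t) (mulP-negʳ p r m))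

mulP-scaleʳ : ∀ c p q → mulP p (scaleP c q) ≗ scaleP c (mulP p q)
mulP-scaleʳ c p q m =
  trans (sumTo-cong m (λ i → x∙yz≈y∙xz (p i) c (q (m ∸ i)))) (sumTo-scale m c (λ i → p i * q (m ∸ i)))

mulP-mulOneMinusYˡ : ∀ p q → mulP (mulOneMinusY p) q ≗ mulOneMinusY (mulP p q)
mulP-mulOneMinusYˡ p q m =
  trans (mulP-distribʳ-subP p (mulY p) q m) (cong (λ t → mulP p q m - t) (mulP-mulYˡ p q m))

mulP-mulOneMinusYʳ : ∀ p q → mulP p (mulOneMinusY q) ≗ mulOneMinusY (mulP p q)
mulP-mulOneMinusYʳ p q m =
  trans (mulP-distribˡ-subP p q (mulY q) m) (cong (λ t → mulP p q m - t) (mulP-mulYʳ p q m))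

oneMinusY≗ : oneMinusY ≗ mulOneMinusY oneP
oneMinusY≗ zero          = refl
oneMinusY≗ (suc zero)    = refl
oneMinusY≗ (suc (suc m)) = refl

onePlusY≗ : onePlusY ≗ addP oneP (mulY oneP)
onePlusY≗ zero          = refl
onePlusY≗ (suc zero)    = refl
onePlusY≗ (suc (suc m)) = refl

mulP-oneMinusYˡ : ∀ p → mulP oneMinusY p ≗ mulOneMinusY p
mulP-oneMinusYˡ p m = begin
  mulP oneMinusY p m                         ≡⟨ mulP-congˡ p oneMinusY≗ m ⟩
  mulP (mulOneMinusY oneP) p m               ≡⟨ mulP-mulOneMinusYˡ oneP p m ⟩
  mulOneMinusY (mulP oneP p) m               ≡⟨ mulOneMinusY-cong (mulP-identityˡ p) m ⟩
  mulOneMinusY p m                           ∎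

mulP-oneMinusY-assoc : ∀ p q → mulP (mulP oneMinusY p) q ≗ mulOneMinusY (mulP p q)
mulP-oneMinusY-assoc p q m = trans (mulP-congˡ q (mulP-oneMinusYˡ p) m) (mulP-mulOneMinusYˡ p q m)

mulP-onePlusYʳ : ∀ p → mulP p onePlusY ≗ addP p (mulY p)
mulP-onePlusYʳ p m = begin
  mulP p onePlusY m                          ≡⟨ mulP-congʳ p onePlusY≗ m ⟩
  mulP p (addP oneP (mulY oneP)) m           ≡⟨ mulP-distribˡ-addP p oneP (mulY oneP) m ⟩
  mulP p oneP m + mulP p (mulY oneP) m
    ≡⟨ cong₂ _+_ (mulP-identityʳ p m) (trans (mulP-mulYʳ p oneP m) (mulY-cong (mulP-identityʳ p) m)) ⟩
  p m + mulY p m                             ∎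

mulP-y^-+ : ∀ a b q → mulP (y^ (a ℕ.+ b)) q ≗ mulP (y^ a) (mulP (y^ b) q)
mulP-y^-+ zero    b q m = sym (mulP-identityˡ (mulP (y^ b) q) m)
mulP-y^-+ (suc a) b q m = begin
  mulP (mulY (y^ (a ℕ.+ b))) q m             ≡⟨ mulP-mulYˡ (y^ (a ℕ.+ b)) q m ⟩
  mulY (mulP (y^ (a ℕ.+ b)) q) m             ≡⟨ mulY-cong (mulP-y^-+ a b q) m ⟩
  mulY (mulP (y^ a) (mulP (y^ b) q)) m       ≡⟨ sym (mulP-mulYˡ (y^ a) (mulP (y^ b) q) m) ⟩
  mulP (mulY (y^ a)) (mulP (y^ b) q) m       ∎

y^-+ : ∀ a b → y^ (a ℕ.+ b) ≗ mulP (y^ a) (y^ b)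
y^-+ a b m = begin
  y^ (a ℕ.+ b) m                             ≡⟨ sym (mulP-identityʳ (y^ (a ℕ.+ b)) m) ⟩
  mulP (y^ (a ℕ.+ b)) oneP m                 ≡⟨ mulP-y^-+ a b oneP m ⟩
  mulP (y^ a) (mulP (y^ b) oneP) m           ≡⟨ mulP-congʳ (y^ a) (mulP-identityʳ (y^ b)) m ⟩
  mulP (y^ a) (y^ b) m                       ∎

-- The polynomials U

twice : ℕ → ℕ
twice zero    = zero
twice (suc q) = suc (suc (twice q))

data Parity : ℕ → Set where
  even : ∀ q → Parity (twice q)
  odd  : ∀ q → Parity (suc (twice q))

parity : ∀ n → Parity n
parity zero = even zero
parity (suc n) with parity n
... | even q = odd q
... | odd q  = even (suc q)

isEven-twice : ∀ q → isEven (twice q) ≡ true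
isEven-twice zero    = refl
isEven-twice (suc q) = cong (not ∘ not) (isEven-twice q)

signPow-twice : ∀ q → signPow (twice q) ≡ + 1
signPow-twice zero    = refl
signPow-twice (suc q) = cong (-_ ∘ -_) (signPow-twice q)

half-twice : ∀ q → half (twice q) ≡ q
half-twice zero    = refl
half-twice (suc q) = cong suc (half-twice q)

half-suc-twice : ∀ q → half (suc (twice q)) ≡ q
half-suc-twice zero    = refl
half-suc-twice (suc q) = cong suc (half-suc-twice q)

U-even-step : ∀ q → U (2 ℕ.+ twice q) ≗ subP (mulOneMinusY (U (1 ℕ.+ twice q))) (U (twice q))
U-even-step q m rewrite isEven-twice q =
  cong (λ t → t - U (twice q) m) (mulP-oneMinusYˡ (U (1 ℕ.+ twice q)) m)

U-odd-step : ∀ q → U (3 ℕ.+ twice q) ≗ subP (U (2 ℕ.+ twice q)) (U (1 ℕ.+ twice q))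
U-odd-step q m rewrite isEven-twice q = refl

U-recurrence : ∀ n m → U (4 ℕ.+ n) m + addP (U (2 ℕ.+ n)) (mulY (U (2 ℕ.+ n))) m + U n m ≡ + 0
U-recurrence n m with parity n
... | even q = cancel (U-even-step q m) (U-odd-step q m)
                      (trans (mulY-cong (U-odd-step q) m) (mulY-subP (U (2 ℕ.+ twice q)) (U (1 ℕ.+ twice q)) m))
                      (U-even-step (suc q) m)
  where
  cancel : ∀ {a ya b c yc u₃ yu₃ u₄} →
    c ≡ a - ya - b → u₃ ≡ c - a → yu₃ ≡ yc - ya → u₄ ≡ u₃ - yu₃ - c → u₄ + (c + yc) + b ≡ + 0
  cancel {a} {ya} {b} {yc = yc} refl refl refl refl = identity a ya b yc
    where
    identity : ∀ a ya b yc → a - ya - b - a - (yc - ya) - (a - ya - b) + (a - ya - b + yc) + b ≡ + 0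
    identity = solve-∀
... | odd q = cancel (U-odd-step q m) (U-even-step (suc q) m) (U-odd-step (suc q) m)
  where
  cancel : ∀ {a b c yc u₃ u₄} → c ≡ a - b → u₃ ≡ c - yc - a → u₄ ≡ u₃ - c → u₄ + (c + yc) + b ≡ + 0
  cancel {a} {b} {yc = yc} refl refl refl = identity a b yc
    where
    identity : ∀ a b yc → a - b - yc - a - (a - b) + (a - b + yc) + b ≡ + 0
    identity = solve-∀

mul2-reverse : ∀ P Q n m → mul2 P Q n m ≡ sumTo n (λ j → mulP (P (n ∸ j)) (Q j) m)
mul2-reverse P Q n m = trans (sumTo-reverse n (λ j → mulP (P j) (Q (n ∸ j)) m))
  (sumTo-cong≤ n (λ j j≤n → cong (λ t → mulP (P (n ∸ j)) (Q t) m) (ℕₚ.m∸[m∸n]≡n j≤n)))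

sumTo-suc⁴ : ∀ n f → sumTo (4 ℕ.+ n) f ≡ f 0 + (f 1 + (f 2 + (f 3 + sumTo n (f ∘ (4 ℕ.+_)))))
sumTo-suc⁴ n f = begin
  sumTo (4 ℕ.+ n) f
    ≡⟨ sumTo-suc (3 ℕ.+ n) f ⟩
  f 0 + sumTo (3 ℕ.+ n) (f ∘ suc)
    ≡⟨ cong (λ s → f 0 + s) (sumTo-suc (2 ℕ.+ n) (f ∘ suc)) ⟩
  f 0 + (f 1 + sumTo (2 ℕ.+ n) (f ∘ (2 ℕ.+_)))
    ≡⟨ cong (λ s → f 0 + (f 1 + s)) (sumTo-suc (1 ℕ.+ n) (f ∘ (2 ℕ.+_))) ⟩
  f 0 + (f 1 + (f 2 + sumTo (1 ℕ.+ n) (f ∘ (3 ℕ.+_))))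
    ≡⟨ cong (λ s → f 0 + (f 1 + (f 2 + s))) (sumTo-suc n (f ∘ (3 ℕ.+_))) ⟩
  f 0 + (f 1 + (f 2 + (f 3 + sumTo n (f ∘ (4 ℕ.+_))))) ∎

mul2-Udenom : ∀ P n m →
  mul2 P Udenom (4 ℕ.+ n) m ≡ P (4 ℕ.+ n) m + addP (P (2 ℕ.+ n)) (mulY (P (2 ℕ.+ n))) m + P n m
mul2-Udenom P n m = begin
  mul2 P Udenom (4 ℕ.+ n) m
    ≡⟨ trans (mul2-reverse P Udenom (4 ℕ.+ n) m) (sumTo-suc⁴ n term) ⟩
  term 0 + (term 1 + (term 2 + (term 3 + sumTo n (term ∘ (4 ℕ.+_)))))
    ≡⟨ cong₂ (λ s₁ s₃ → term 0 + (s₁ + (term 2 + (s₃ + sumTo n (term ∘ (4 ℕ.+_))))))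
             (mulP-zeroʳ (P (3 ℕ.+ n)) m) (mulP-zeroʳ (P (1 ℕ.+ n)) m) ⟩
  term 0 + (+ 0 + (term 2 + (+ 0 + sumTo n (term ∘ (4 ℕ.+_)))))
    ≡⟨ drop-zeros (term 0) (term 2) (sumTo n (term ∘ (4 ℕ.+_))) ⟩
  term 0 + term 2 + sumTo n (term ∘ (4 ℕ.+_))
    ≡⟨ cong₃ (mulP-identityʳ (P (4 ℕ.+ n)) m) (mulP-onePlusYʳ (P (2 ℕ.+ n)) m)
             (trans (tail n) (mulP-identityʳ (P n) m)) ⟩
  P (4 ℕ.+ n) m + addP (P (2 ℕ.+ n)) (mulY (P (2 ℕ.+ n))) m + P n m ∎
  where
  term : ℕ → ℤ
  term j = mulP (P (4 ℕ.+ n ∸ j)) (Udenom j) m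
  drop-zeros : ∀ a b c → a + (+ 0 + (b + (+ 0 + c))) ≡ a + b + c
  drop-zeros = solve-∀
  cong₃ : ∀ {a a′ b b′ c c′ : ℤ} → a ≡ a′ → b ≡ b′ → c ≡ c′ → a + b + c ≡ a′ + b′ + c′
  cong₃ refl refl refl = refl
  tail : ∀ n → sumTo n (λ j → mulP (P (n ∸ j)) (Udenom (4 ℕ.+ j)) m) ≡ mulP (P n) oneP m
  tail zero    = refl
  tail (suc n) = trans (sumTo-suc n (λ j → mulP (P (suc n ∸ j)) (Udenom (4 ℕ.+ j)) m))
    (trans (cong (λ s → mulP (P (suc n)) oneP m + s) (sumTo-zero n _ (λ j _ → mulP-zeroʳ (P (n ∸ j)) m)))
           (ℤₚ.+-identityʳ (mulP (P (suc n)) oneP m)))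

Useries-Udenom : ∀ n m → mul2 Useries Udenom n m ≡ Unum n m
Useries-Udenom 0 m = mulP-identityˡ oneP m
Useries-Udenom 1 m =
  trans (cong₂ _+_ (mulP-zeroʳ oneP m) (mulP-identityˡ oneP m)) (ℤₚ.+-identityˡ (oneP m))
Useries-Udenom 2 m =
  trans (cong₂ _+_ (cong₂ _+_ (mulP-identityˡ onePlusY m) (mulP-zeroʳ oneP m))
                   (trans (mulP-identityʳ (U 2) m) (cong (λ t → t - oneP m) (mulP-identityʳ oneMinusY m))))
        (closed m)
  where
  closed : ∀ m → onePlusY m + + 0 + (oneMinusY m - oneP m) ≡ Unum 2 m
  closed 0             = refl
  closed 1             = refl
  closed (suc (suc m)) = refl
Useries-Udenom 3 m =
  trans (cong₂ _+_ (cong₂ _+_ (cong₂ _+_ (mulP-zeroʳ oneP m) (mulP-identityˡ onePlusY m))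
                               (mulP-zeroʳ (U 2) m))
                   (trans (mulP-identityʳ (U 3) m)
                          (cong (λ t → t - oneP m - oneP m) (mulP-identityʳ oneMinusY m))))
        (closed m)
  where
  closed : ∀ m → + 0 + onePlusY m + + 0 + (oneMinusY m - oneP m - oneP m) ≡ Unum 3 m
  closed 0             = refl
  closed 1             = refl
  closed (suc (suc m)) = refl
Useries-Udenom (suc (suc (suc (suc n)))) m = trans (mul2-Udenom Useries n m) (U-recurrence n m)

-- Weights of ascending blocks

blockWeight : ℕ → Coef
blockWeight zero                = zeroP
blockWeight (suc zero)          = oneP
blockWeight (suc (suc zero))    = zeroP
blockWeight (suc (suc (suc i))) =
  scaleP (signPow (3 ℕ.+ i)) (mulP (powP oneMinusY (half (3 ℕ.+ i))) (U i))

blockWeight-odd : ∀ q → blockWeight (3 ℕ.+ twice q) ≗ negP (mulP (powP oneMinusY (suc q)) (U (twice q)))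
blockWeight-odd q m rewrite signPow-twice q | half-suc-twice q = ℤₚ.-1*i≡-i _

blockWeight-even : ∀ q → blockWeight (4 ℕ.+ twice q) ≗ mulP (powP oneMinusY (2 ℕ.+ q)) (U (1 ℕ.+ twice q))
blockWeight-even q m rewrite signPow-twice q | half-twice q = ℤₚ.*-identityˡ _

blockResidual : ℕ → Coef
blockResidual t = addP (blockWeight (2 ℕ.+ t)) (mulOneMinusY (addP (blockWeight (1 ℕ.+ t)) (blockWeight t)))

blockResidual-one : blockResidual 1 ≗ zeroP
blockResidual-one m = begin
  blockWeight 3 m + mulOneMinusY (addP zeroP oneP) m
    ≡⟨ cong₂ _+_ (blockWeight-odd 0 m) (mulOneMinusY-cong (λ m → ℤₚ.+-identityˡ (oneP m)) m) ⟩
  - mulP (mulP oneMinusY oneP) oneP m + mulOneMinusY oneP m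
    ≡⟨ cong (λ t → - t + mulOneMinusY oneP m)
            (trans (mulP-oneMinusY-assoc oneP oneP m) (mulOneMinusY-cong (mulP-identityˡ oneP) m)) ⟩
  - mulOneMinusY oneP m + mulOneMinusY oneP m
    ≡⟨ ℤₚ.+-inverseˡ (mulOneMinusY oneP m) ⟩
  + 0 ∎

blockResidual-two : blockResidual 2 ≗ zeroP
blockResidual-two m = begin
  blockWeight 4 m + mulOneMinusY (addP (blockWeight 3) zeroP) m
    ≡⟨ cong₂ _+_ (trans (blockWeight-even 0 m) (mulP-oneMinusY-assoc P₁ oneP m))
                 (mulOneMinusY-cong (λ m → trans (ℤₚ.+-identityʳ (blockWeight 3 m)) (blockWeight-odd 0 m)) m) ⟩
  mulOneMinusY (mulP P₁ oneP) m + mulOneMinusY (negP (mulP P₁ oneP)) m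
    ≡⟨ cong (λ t → mulOneMinusY (mulP P₁ oneP) m + t) (mulOneMinusY-negP (mulP P₁ oneP) m) ⟩
  mulOneMinusY (mulP P₁ oneP) m - mulOneMinusY (mulP P₁ oneP) m
    ≡⟨ ℤₚ.+-inverseʳ (mulOneMinusY (mulP P₁ oneP) m) ⟩
  + 0 ∎
  where
  P₁ = powP oneMinusY 1

blockResidual-odd : ∀ q → blockResidual (3 ℕ.+ twice q) ≗ zeroP
blockResidual-odd q m = begin
  blockWeight (5 ℕ.+ twice q) m + mulOneMinusY (addP (blockWeight (4 ℕ.+ twice q)) (blockWeight (3 ℕ.+ twice q))) m
    ≡⟨ cong₂ _+_ (trans (blockWeight-odd (suc q) m) (cong -_ (P₂U₂ m)))
                 (mulOneMinusY-cong (λ m → cong₂ _+_ (blockWeight-even q m) (blockWeight-odd q m)) m) ⟩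
  - D m + mulOneMinusY (subP A₁ A₀) m
    ≡⟨ cong (λ t → - D m + t) (mulOneMinusY-subP A₁ A₀ m) ⟩
  - D m + D m
    ≡⟨ ℤₚ.+-inverseˡ (D m) ⟩
  + 0 ∎
  where
  P₁ = powP oneMinusY (1 ℕ.+ q)
  P₂ = powP oneMinusY (2 ℕ.+ q)
  A₀ = mulP P₁ (U (twice q))
  A₁ = mulP P₂ (U (1 ℕ.+ twice q))
  D = subP (mulOneMinusY A₁) (mulOneMinusY A₀)
  P₂U₂ : mulP P₂ (U (2 ℕ.+ twice q)) ≗ D
  P₂U₂ m = begin
    mulP P₂ (U (2 ℕ.+ twice q)) m
      ≡⟨ mulP-congʳ P₂ (U-even-step q) m ⟩
    mulP P₂ (subP (mulOneMinusY (U (1 ℕ.+ twice q))) (U (twice q))) m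
      ≡⟨ mulP-distribˡ-subP P₂ (mulOneMinusY (U (1 ℕ.+ twice q))) (U (twice q)) m ⟩
    mulP P₂ (mulOneMinusY (U (1 ℕ.+ twice q))) m - mulP P₂ (U (twice q)) m
      ≡⟨ cong₂ _-_ (mulP-mulOneMinusYʳ P₂ (U (1 ℕ.+ twice q)) m) (mulP-oneMinusY-assoc P₁ (U (twice q)) m) ⟩
    D m ∎

blockResidual-even : ∀ q → blockResidual (4 ℕ.+ twice q) ≗ zeroP
blockResidual-even q m = begin
  blockWeight (6 ℕ.+ twice q) m + mulOneMinusY (addP (blockWeight (5 ℕ.+ twice q)) (blockWeight (4 ℕ.+ twice q))) m
    ≡⟨ cong₂ _+_ (trans (blockWeight-even (suc q) m) (P₃U₃ m)) (mulOneMinusY-cong sum₅₄ m) ⟩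
  mulOneMinusY D m + mulOneMinusY (negP D) m
    ≡⟨ cong (λ t → mulOneMinusY D m + t) (mulOneMinusY-negP D m) ⟩
  mulOneMinusY D m - mulOneMinusY D m
    ≡⟨ ℤₚ.+-inverseʳ (mulOneMinusY D m) ⟩
  + 0 ∎
  where
  P₂ = powP oneMinusY (2 ℕ.+ q)
  A₁ = mulP P₂ (U (1 ℕ.+ twice q))
  A₂ = mulP P₂ (U (2 ℕ.+ twice q))
  D = subP A₂ A₁
  neg-sub : ∀ a b → - a + b ≡ - (a - b)
  neg-sub = solve-∀
  sum₅₄ : addP (blockWeight (5 ℕ.+ twice q)) (blockWeight (4 ℕ.+ twice q)) ≗ negP D
  sum₅₄ m = trans (cong₂ _+_ (blockWeight-odd (suc q) m) (blockWeight-even q m)) (neg-sub (A₂ m) (A₁ m))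
  P₃U₃ : mulP (powP oneMinusY (3 ℕ.+ q)) (U (3 ℕ.+ twice q)) ≗ mulOneMinusY D
  P₃U₃ m = begin
    mulP (mulP oneMinusY P₂) (U (3 ℕ.+ twice q)) m
      ≡⟨ mulP-oneMinusY-assoc P₂ (U (3 ℕ.+ twice q)) m ⟩
    mulOneMinusY (mulP P₂ (U (3 ℕ.+ twice q))) m
      ≡⟨ mulOneMinusY-cong (λ m → trans (mulP-congʳ P₂ (U-odd-step q) m)
                                        (mulP-distribˡ-subP P₂ (U (2 ℕ.+ twice q)) (U (1 ℕ.+ twice q)) m)) m ⟩
    mulOneMinusY D m ∎

blockResidual-suc : ∀ t → blockResidual (suc t) ≗ zeroP
blockResidual-suc zero          = blockResidual-one
blockResidual-suc (suc zero)    = blockResidual-two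
blockResidual-suc (suc (suc t)) with parity t
... | even q = blockResidual-odd q
... | odd q  = blockResidual-even q

-- Factorisations into ascending blocks

occ123ℕ : List ℕ → ℕ
occ123ℕ (a ∷ rest@(b ∷ c ∷ _)) = (if (a <ᵇ b) ∧ (b <ᵇ c) then 1 else 0) ℕ.+ occ123ℕ rest
occ123ℕ _                      = 0

letters : ∀ {k n} → Vec (Fin k) n → List ℕ
letters = Vec.toList ∘ Vec.map toℕ

occ123-letters : ∀ {k n} (w : Vec (Fin k) n) → occ123 w ≡ occ123ℕ (letters w)
occ123-letters []              = refl
occ123-letters (a ∷ [])        = refl
occ123-letters (a ∷ b ∷ [])    = refl
occ123-letters (a ∷ b ∷ c ∷ w) = cong (_ ℕ.+_) (occ123-letters (b ∷ c ∷ w))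

ascentLength : ℕ → List ℕ → ℕ
ascentLength a []      = 0
ascentLength a (b ∷ w) = if a <ᵇ b then suc (ascentLength b w) else 0

afterAscent : ℕ → List ℕ → List ℕ
afterAscent a []      = []
afterAscent a (b ∷ w) = if a <ᵇ b then afterAscent b w else b ∷ w

occ123ℕ-ascent : ∀ a w → occ123ℕ (a ∷ w) ≡ (ascentLength a w ∸ 1) ℕ.+ occ123ℕ (afterAscent a w)
occ123ℕ-ascent a []      = refl
occ123ℕ-ascent a (b ∷ []) with a <ᵇ b
... | true  = refl
... | false = refl
occ123ℕ-ascent a (b ∷ c ∷ w) with a <ᵇ b | occ123ℕ-ascent b (c ∷ w)
... | false | _  = refl
... | true  | ih with b <ᵇ c
...   | true  = cong suc ih
...   | false = ih

-- factorWeight w sums, over all factorisations of w into strictly ascending blocks, the product of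
-- the blockWeights of the block lengths; in openWeight j a w the current block has j letters, the
-- last of which is a.
mutual
  factorWeight : List ℕ → Coef
  factorWeight []      = oneP
  factorWeight (a ∷ w) = openWeight 1 a w

  openWeight : ℕ → ℕ → List ℕ → Coef
  openWeight j a []      = blockWeight j
  openWeight j a (b ∷ w) =
    addP (mulP (factorWeight (b ∷ w)) (blockWeight j)) (if a <ᵇ b then openWeight (suc j) b w else zeroP)

-- The same sum restricted to an ascending run: the current block has j letters and s letters of the
-- run follow it.  Closing the block leaves a run of s letters, which carries y^(s ∸ 2).
runWeight : ℕ → ℕ → Coef
runWeight j zero    = blockWeight j
runWeight j (suc s) = addP (mulP (y^ (s ∸ 1)) (blockWeight j)) (runWeight (suc j) s)

runWeight-step : ∀ r j → runWeight j (2 ℕ.+ r) ≗ addP (mulY (runWeight j (1 ℕ.+ r))) (blockResidual (j ℕ.+ r))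
runWeight-step zero j m = begin
  mulP oneP g₀ m + (mulP oneP g₁ m + g₂ m)
    ≡⟨ cong₂ (λ s t → s + (t + g₂ m)) (mulP-identityˡ g₀ m) (mulP-identityˡ g₁ m) ⟩
  g₀ m + (g₁ m + g₂ m)
    ≡⟨ rearrange (g₀ m) (g₁ m) (g₂ m) (mulY g₀ m) (mulY g₁ m) ⟩
  (mulY g₀ m + mulY g₁ m) + (g₂ m + ((g₁ m + g₀ m) - (mulY g₁ m + mulY g₀ m)))
    ≡⟨ cong₂ _+_ (sym (trans (mulY-cong (λ m → cong (λ s → s + g₁ m) (mulP-identityˡ g₀ m)) m)
                             (mulY-addP g₀ g₁ m)))
                 (cong (λ t → g₂ m + ((g₁ m + g₀ m) - t)) (sym (mulY-addP g₁ g₀ m))) ⟩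
  mulY (runWeight j 1) m + blockResidual j m
    ≡⟨ cong (λ t → mulY (runWeight j 1) m + blockResidual t m) (sym (ℕₚ.+-identityʳ j)) ⟩
  mulY (runWeight j 1) m + blockResidual (j ℕ.+ 0) m ∎
  where
  g₀ = blockWeight j
  g₁ = blockWeight (1 ℕ.+ j)
  g₂ = blockWeight (2 ℕ.+ j)
  rearrange : ∀ a b c ya yb → a + (b + c) ≡ (ya + yb) + (c + ((b + a) - (yb + ya)))
  rearrange = solve-∀
runWeight-step (suc r) j m = begin
  x + runWeight (suc j) (2 ℕ.+ r) m
    ≡⟨ cong₂ _+_ (mulP-mulYˡ (y^ r) (blockWeight j) m) (runWeight-step r (suc j) m) ⟩
  mulY X m + (mulY R m + blockResidual (suc j ℕ.+ r) m)
    ≡⟨ sym (ℤₚ.+-assoc (mulY X m) (mulY R m) (blockResidual (suc j ℕ.+ r) m)) ⟩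
  mulY X m + mulY R m + blockResidual (suc j ℕ.+ r) m
    ≡⟨ cong₂ _+_ (sym (mulY-addP X R m)) (cong (λ t → blockResidual t m) (sym (ℕₚ.+-suc j r))) ⟩
  mulY (runWeight j (2 ℕ.+ r)) m + blockResidual (j ℕ.+ suc r) m ∎
  where
  x = mulP (y^ (suc r)) (blockWeight j) m
  X = mulP (y^ r) (blockWeight j)
  R = runWeight (suc j) (1 ℕ.+ r)

runWeight-one : ∀ s → runWeight 1 s ≗ y^ (s ∸ 1)
runWeight-one zero          m = refl
runWeight-one (suc zero)    m = trans (ℤₚ.+-identityʳ (mulP oneP oneP m)) (mulP-identityˡ oneP m)
runWeight-one (suc (suc r)) m = begin
  runWeight 1 (2 ℕ.+ r) m
    ≡⟨ runWeight-step r 1 m ⟩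
  mulY (runWeight 1 (1 ℕ.+ r)) m + blockResidual (suc r) m
    ≡⟨ cong₂ _+_ (mulY-cong (runWeight-one (suc r)) m) (blockResidual-suc r m) ⟩
  mulY (y^ r) m + + 0
    ≡⟨ ℤₚ.+-identityʳ (mulY (y^ r) m) ⟩
  y^ (suc r) m ∎

openWeight-ascent-∷ : ∀ j a b w →
  factorWeight (b ∷ w) ≗ y^ (occ123ℕ (b ∷ w)) →
  openWeight (suc j) b w ≗ mulP (y^ (occ123ℕ (afterAscent b w))) (runWeight (suc j) (ascentLength b w)) →
  openWeight j a (b ∷ w) ≗ mulP (y^ (occ123ℕ (afterAscent a (b ∷ w)))) (runWeight j (ascentLength a (b ∷ w)))
openWeight-ascent-∷ j a b w factor-b∷w open-b m with a <ᵇ b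
... | false = trans (ℤₚ.+-identityʳ _) (mulP-congˡ (blockWeight j) factor-b∷w m)
... | true  = begin
  mulP (factorWeight (b ∷ w)) g m + openWeight (suc j) b w m
    ≡⟨ cong₂ _+_ (mulP-congˡ g factor-b∷w m) (open-b m) ⟩
  mulP (y^ (occ123ℕ (b ∷ w))) g m + mulP (y^ o) R m
    ≡⟨ cong (λ e → mulP (y^ e) g m + mulP (y^ o) R m) (trans (occ123ℕ-ascent b w) (ℕₚ.+-comm (l ∸ 1) o)) ⟩
  mulP (y^ (o ℕ.+ (l ∸ 1))) g m + mulP (y^ o) R m
    ≡⟨ cong (λ t → t + mulP (y^ o) R m) (mulP-y^-+ o (l ∸ 1) g m) ⟩
  mulP (y^ o) (mulP (y^ (l ∸ 1)) g) m + mulP (y^ o) R m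
    ≡⟨ sym (mulP-distribˡ-addP (y^ o) (mulP (y^ (l ∸ 1)) g) R m) ⟩
  mulP (y^ o) (runWeight j (suc l)) m ∎
  where
  g = blockWeight j
  o = occ123ℕ (afterAscent b w)
  l = ascentLength b w
  R = runWeight (suc j) l

mutual
  factorWeight-occ123 : ∀ w → factorWeight w ≗ y^ (occ123ℕ w)
  factorWeight-occ123 []      m = refl
  factorWeight-occ123 (a ∷ w) m = begin
    openWeight 1 a w m
      ≡⟨ openWeight-ascent 1 a w m ⟩
    mulP (y^ o) (runWeight 1 l) m
      ≡⟨ mulP-congʳ (y^ o) (runWeight-one l) m ⟩
    mulP (y^ o) (y^ (l ∸ 1)) m
      ≡⟨ sym (y^-+ o (l ∸ 1) m) ⟩
    y^ (o ℕ.+ (l ∸ 1)) m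
      ≡⟨ cong (λ e → y^ e m) (trans (ℕₚ.+-comm o (l ∸ 1)) (sym (occ123ℕ-ascent a w))) ⟩
    y^ (occ123ℕ (a ∷ w)) m ∎
    where
    o = occ123ℕ (afterAscent a w)
    l = ascentLength a w

  openWeight-ascent : ∀ j a w →
    openWeight j a w ≗ mulP (y^ (occ123ℕ (afterAscent a w))) (runWeight j (ascentLength a w))
  openWeight-ascent j a []      m = sym (mulP-identityˡ (blockWeight j) m)
  openWeight-ascent j a (b ∷ w)   =
    openWeight-ascent-∷ j a b w (factorWeight-occ123 (b ∷ w)) (openWeight-ascent (suc j) b w)

-- Summing over all words

sumList : {A : Set} → List A → (A → ℤ) → ℤ
sumList []       f = + 0
sumList (x ∷ xs) f = f x + sumList xs f

sumBelow : ℕ → (ℕ → ℤ) → ℤ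
sumBelow zero    f = + 0
sumBelow (suc k) f = f 0 + sumBelow k (f ∘ suc)

sumList-cong : ∀ {A : Set} (xs : List A) {f g : A → ℤ} → f ≗ g → sumList xs f ≡ sumList xs g
sumList-cong []       f≗g = refl
sumList-cong (x ∷ xs) f≗g = cong₂ _+_ (f≗g x) (sumList-cong xs f≗g)

sumList-zero : ∀ {A : Set} (xs : List A) → sumList xs (λ _ → + 0) ≡ + 0
sumList-zero []       = refl
sumList-zero (x ∷ xs) = trans (ℤₚ.+-identityˡ (sumList xs (λ _ → + 0))) (sumList-zero xs)

sumList-++ : ∀ {A : Set} (xs ys : List A) f → sumList (xs ++ ys) f ≡ sumList xs f + sumList ys f
sumList-++ []       ys f = sym (ℤₚ.+-identityˡ (sumList ys f))
sumList-++ (x ∷ xs) ys f =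
  trans (cong (λ s → f x + s) (sumList-++ xs ys f)) (sym (ℤₚ.+-assoc (f x) (sumList xs f) (sumList ys f)))

sumList-map : ∀ {A B : Set} (g : A → B) xs f → sumList (map g xs) f ≡ sumList xs (f ∘ g)
sumList-map g []       f = refl
sumList-map g (x ∷ xs) f = cong (λ s → f (g x) + s) (sumList-map g xs f)

sumList-concatMap : ∀ {A B : Set} (g : A → List B) xs f →
  sumList (concatMap g xs) f ≡ sumList xs (λ x → sumList (g x) f)
sumList-concatMap g []       f = refl
sumList-concatMap g (x ∷ xs) f =
  trans (sumList-++ (g x) (concatMap g xs) f) (cong (λ s → sumList (g x) f + s) (sumList-concatMap g xs f))

sumList-distrib-+ : ∀ {A : Set} (xs : List A) f g → sumList xs (λ x → f x + g x) ≡ sumList xs f + sumList xs g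
sumList-distrib-+ []       f g = refl
sumList-distrib-+ (x ∷ xs) f g =
  trans (cong (λ s → f x + g x + s) (sumList-distrib-+ xs f g))
        (interchange (f x) (g x) (sumList xs f) (sumList xs g))

sumList-mulP : ∀ {A : Set} (xs : List A) (F : A → Coef) q m →
  sumList xs (λ x → mulP (F x) q m) ≡ mulP (λ i → sumList xs (λ x → F x i)) q m
sumList-mulP []       F q m = sym (mulP-zeroˡ q m)
sumList-mulP (x ∷ xs) F q m =
  trans (cong (λ s → mulP (F x) q m + s) (sumList-mulP xs F q m))
        (sym (mulP-distribʳ-addP (F x) (λ i → sumList xs (λ x → F x i)) q m))

sumList-if : ∀ {A : Set} (xs : List A) c (F : A → Coef) m →
  sumList xs (λ x → (if c then F x else zeroP) m) ≡ (if c then sumList xs (λ x → F x m) else + 0)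
sumList-if xs true  F m = refl
sumList-if xs false F m = sumList-zero xs

sumList-allFin : ∀ k f → sumList (allFin k) (f ∘ toℕ) ≡ sumBelow k f
sumList-allFin k f = tabulate-toℕ k (λ i → i) (λ _ → refl)
  where
  tabulate-toℕ : ∀ {A : Set} {h : A → ℤ} k {f : ℕ → ℤ} (g : Fin k → A) →
    (∀ i → h (g i) ≡ f (toℕ i)) → sumList (tabulate g) h ≡ sumBelow k f
  tabulate-toℕ zero    g hg≡f = refl
  tabulate-toℕ (suc k) g hg≡f = cong₂ _+_ (hg≡f Fin.zero) (tabulate-toℕ k (g ∘ Fin.suc) (hg≡f ∘ Fin.suc))

sumList-allWords-suc : ∀ k n (f : Vec (Fin k) (suc n) → ℤ) →
  sumList (allWords k (suc n)) f ≡ sumList (allFin k) (λ b → sumList (allWords k n) (λ w → f (b ∷ w)))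
sumList-allWords-suc k n f =
  trans (sumList-concatMap _ (allFin k) f)
        (sumList-cong (allFin k) (λ b → sumList-map (b ∷_) (allWords k n) f))

sumBelow-cong : ∀ k {f g : ℕ → ℤ} → f ≗ g → sumBelow k f ≡ sumBelow k g
sumBelow-cong zero    f≗g = refl
sumBelow-cong (suc k) f≗g = cong₂ _+_ (f≗g 0) (sumBelow-cong k (f≗g ∘ suc))

sumBelow-exchange : ∀ k n (c : ℕ → ℕ → ℤ) (x : ℕ → ℤ) →
  sumBelow k (λ b → sumTo n (λ i → c b i * x i)) ≡ sumTo n (λ i → sumBelow k (λ b → c b i) * x i)
sumBelow-exchange zero    n c x = sym (sumTo-zero n (λ i → + 0 * x i) (λ _ _ → refl))
sumBelow-exchange (suc k) n c x = begin
  sumTo n (λ i → c 0 i * x i) + sumBelow k (λ b → sumTo n (λ i → c (suc b) i * x i))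
    ≡⟨ cong (λ s → sumTo n (λ i → c 0 i * x i) + s) (sumBelow-exchange k n (c ∘ suc) x) ⟩
  sumTo n (λ i → c 0 i * x i) + sumTo n (λ i → sumBelow k (λ b → c (suc b) i) * x i)
    ≡⟨ sym (sumTo-distrib-+ n _ _) ⟩
  sumTo n (λ i → c 0 i * x i + sumBelow k (λ b → c (suc b) i) * x i)
    ≡⟨ sumTo-cong n (λ i → sym (ℤₚ.*-distribʳ-+ (x i) (c 0 i) _)) ⟩
  sumTo n (λ i → sumBelow (suc k) (λ b → c b i) * x i) ∎

hockey-stick : ∀ k i → sumBelow k (λ b → + ((k ∸ suc b) C i)) ≡ + (k C suc i)
hockey-stick zero    i = refl
hockey-stick (suc k) i =
  trans (cong (λ s → + (k C i) + s) (hockey-stick k i)) (cong +_ (nCk+nC[k+1]≡[n+1]C[k+1] k i))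

hockey-stick-above : ∀ k a i →
  sumBelow k (λ b → if a <ᵇ b then + ((k ∸ suc b) C i) else + 0) ≡ + ((k ∸ suc a) C suc i)
hockey-stick-above zero    a       i = refl
hockey-stick-above (suc k) zero    i = trans (ℤₚ.+-identityˡ _) (hockey-stick k i)
hockey-stick-above (suc k) (suc a) i = trans (ℤₚ.+-identityˡ _) (hockey-stick-above k a i)

wordWeight : ℕ → ℕ → Coef
wordWeight k n m = sumList (allWords k n) (λ w → factorWeight (letters w) m)

openWordWeight : ℕ → ℕ → ℕ → ℕ → Coef
openWordWeight k n j a m = sumList (allWords k n) (λ w → openWeight j a (letters w) m)

openWordWeight-suc : ∀ k n j a m → openWordWeight k (suc n) j a m ≡
  mulP (wordWeight k (suc n)) (blockWeight j) m
    + sumBelow k (λ b → if a <ᵇ b then openWordWeight k n (suc j) b m else + 0)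
openWordWeight-suc k n j a m = begin
  openWordWeight k (suc n) j a m
    ≡⟨ sumList-allWords-suc k n (λ w → openWeight j a (letters w) m) ⟩
  sumList (allFin k) (λ b → sumList ws (λ w → openWeight j a (toℕ b ∷ letters w) m))
    ≡⟨ sumList-cong (allFin k) (split ∘ toℕ) ⟩
  sumList (allFin k) (λ b → mulP (first (toℕ b)) g m + extend (toℕ b))
    ≡⟨ sumList-distrib-+ (allFin k) (λ b → mulP (first (toℕ b)) g m) (extend ∘ toℕ) ⟩
  sumList (allFin k) (λ b → mulP (first (toℕ b)) g m) + sumList (allFin k) (extend ∘ toℕ)
    ≡⟨ cong₂ _+_ (sumList-mulP (allFin k) (first ∘ toℕ) g m) (sumList-allFin k extend) ⟩
  mulP (λ i → sumList (allFin k) (λ b → first (toℕ b) i)) g m + sumBelow k extend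
    ≡⟨ cong (λ s → s + sumBelow k extend)
            (mulP-congˡ g (λ i → sym (sumList-allWords-suc k n (λ w → factorWeight (letters w) i))) m) ⟩
  mulP (wordWeight k (suc n)) g m + sumBelow k extend ∎
  where
  ws = allWords k n
  g = blockWeight j
  first : ℕ → Coef
  first b i = sumList ws (λ w → factorWeight (b ∷ letters w) i)
  extend : ℕ → ℤ
  extend b = if a <ᵇ b then openWordWeight k n (suc j) b m else + 0
  split : ∀ b → sumList ws (λ w → openWeight j a (b ∷ letters w) m) ≡ mulP (first b) g m + extend b
  split b = trans (sumList-distrib-+ ws _ _)
    (cong₂ _+_ (sumList-mulP ws (λ w → factorWeight (b ∷ letters w)) g m)
               (sumList-if ws (a <ᵇ b) (λ w → openWeight (suc j) b (letters w)) m))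

openWordWeight-closed : ∀ k n j a m → openWordWeight k n j a m ≡
  sumTo n (λ i → + ((k ∸ suc a) C i) * mulP (wordWeight k (n ∸ i)) (blockWeight (j ℕ.+ i)) m)
openWordWeight-closed k zero j a m = sym (begin
  + 1 * mulP (wordWeight k 0) (blockWeight (j ℕ.+ 0)) m
    ≡⟨ ℤₚ.*-identityˡ _ ⟩
  mulP (wordWeight k 0) (blockWeight (j ℕ.+ 0)) m
    ≡⟨ mulP-cong (λ i → ℤₚ.+-identityʳ (oneP i)) (λ i → cong (λ t → blockWeight t i) (ℕₚ.+-identityʳ j)) m ⟩
  mulP oneP (blockWeight j) m
    ≡⟨ mulP-identityˡ (blockWeight j) m ⟩
  blockWeight j m
    ≡⟨ sym (ℤₚ.+-identityʳ (blockWeight j m)) ⟩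
  openWordWeight k 0 j a m ∎)
openWordWeight-closed k (suc n) j a m = begin
  openWordWeight k (suc n) j a m
    ≡⟨ openWordWeight-suc k n j a m ⟩
  mulP (wordWeight k (suc n)) (blockWeight j) m + sumBelow k extend
    ≡⟨ cong₂ _+_ (sym first-term) extensions ⟩
  + 1 * term (suc n) 0 + sumTo n (λ i → + ((k ∸ suc a) C suc i) * term (suc n) (suc i))
    ≡⟨ sym (sumTo-suc n (λ i → + ((k ∸ suc a) C i) * term (suc n) i)) ⟩
  sumTo (suc n) (λ i → + ((k ∸ suc a) C i) * term (suc n) i) ∎
  where
  term : ℕ → ℕ → ℤ
  term n′ i = mulP (wordWeight k (n′ ∸ i)) (blockWeight (j ℕ.+ i)) m
  first-term : + 1 * term (suc n) 0 ≡ mulP (wordWeight k (suc n)) (blockWeight j) m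
  first-term = trans (ℤₚ.*-identityˡ (term (suc n) 0))
                     (cong (λ t → mulP (wordWeight k (suc n)) (blockWeight t) m) (ℕₚ.+-identityʳ j))
  X : ℕ → ℤ
  X i = mulP (wordWeight k (n ∸ i)) (blockWeight (suc j ℕ.+ i)) m
  extend : ℕ → ℤ
  extend b = if a <ᵇ b then openWordWeight k n (suc j) b m else + 0
  above : ℕ → ℕ → ℤ
  above b i = if a <ᵇ b then + ((k ∸ suc b) C i) else + 0
  extend-closed : ∀ b → extend b ≡ sumTo n (λ i → above b i * X i)
  extend-closed b with a <ᵇ b
  ... | true  = openWordWeight-closed k n (suc j) b m
  ... | false = sym (sumTo-zero n (λ i → + 0 * X i) (λ _ _ → refl))
  extensions : sumBelow k extend ≡ sumTo n (λ i → + ((k ∸ suc a) C suc i) * term (suc n) (suc i))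
  extensions = begin
    sumBelow k extend                                    ≡⟨ sumBelow-cong k extend-closed ⟩
    sumBelow k (λ b → sumTo n (λ i → above b i * X i))   ≡⟨ sumBelow-exchange k n above X ⟩
    sumTo n (λ i → sumBelow k (λ b → above b i) * X i)
      ≡⟨ sumTo-cong n (λ i → cong₂ _*_ (hockey-stick-above k a i)
           (cong (λ t → mulP (wordWeight k (n ∸ i)) (blockWeight t) m) (sym (ℕₚ.+-suc j i)))) ⟩
    sumTo n (λ i → + ((k ∸ suc a) C suc i) * term (suc n) (suc i)) ∎

wordWeight-suc : ∀ k n m →
  wordWeight k (suc n) m ≡ sumTo n (λ i → + (k C suc i) * mulP (wordWeight k (n ∸ i)) (blockWeight (suc i)) m)
wordWeight-suc k n m = begin
  wordWeight k (suc n) m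
    ≡⟨ sumList-allWords-suc k n (λ w → factorWeight (letters w) m) ⟩
  sumList (allFin k) (λ b → openWordWeight k n 1 (toℕ b) m)
    ≡⟨ sumList-allFin k (λ b → openWordWeight k n 1 b m) ⟩
  sumBelow k (λ b → openWordWeight k n 1 b m)
    ≡⟨ sumBelow-cong k (λ b → openWordWeight-closed k n 1 b m) ⟩
  sumBelow k (λ b → sumTo n (λ i → + ((k ∸ suc b) C i) * X i))
    ≡⟨ sumBelow-exchange k n (λ b i → + ((k ∸ suc b) C i)) X ⟩
  sumTo n (λ i → sumBelow k (λ b → + ((k ∸ suc b) C i)) * X i)
    ≡⟨ sumTo-cong n (λ i → cong (_* X i) (hockey-stick k i)) ⟩
  sumTo n (λ i → + (k C suc i) * X i) ∎
  where
  X : ℕ → ℤ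
  X i = mulP (wordWeight k (n ∸ i)) (blockWeight (suc i)) m

length-filterᵇ : ∀ {A : Set} (p : A → Bool) xs →
  + length (filterᵇ p xs) ≡ sumList xs (λ x → if p x then + 1 else + 0)
length-filterᵇ p []       = refl
length-filterᵇ p (x ∷ xs) with p x
... | true  = cong (λ s → + 1 + s) (length-filterᵇ p xs)
... | false = trans (length-filterᵇ p xs) (sym (ℤₚ.+-identityˡ _))

F123≗wordWeight : ∀ k n → F123 k n ≗ wordWeight k n
F123≗wordWeight k n m =
  trans (length-filterᵇ (λ w → occ123 w ≡ᵇ m) (allWords k n)) (sumList-cong (allWords k n) indicator)
  where
  indicator : ∀ w → (if occ123 w ≡ᵇ m then + 1 else + 0) ≡ factorWeight (letters w) m
  indicator w = begin
    (if occ123 w ≡ᵇ m then + 1 else + 0)   ≡⟨ sym (y^-coefficient (occ123 w) m) ⟩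
    y^ (occ123 w) m                        ≡⟨ cong (λ e → y^ e m) (occ123-letters w) ⟩
    y^ (occ123ℕ (letters w)) m             ≡⟨ sym (factorWeight-occ123 (letters w) m) ⟩
    factorWeight (letters w) m             ∎

-- The cut-off j ≤ k in the definition of denom is harmless: C(k,j) = 0 for j > k.
denom-blockWeight : ∀ k l → denom k (suc l) ≗ scaleP (- + (k C suc l)) (blockWeight (suc l))
denom-blockWeight k zero          m = cong (λ t → - (+ t) * oneP m) (sym (nC1≡n k))
denom-blockWeight k (suc zero)    m = sym (ℤₚ.*-zeroʳ (- (+ (k C 2))))
denom-blockWeight k (suc (suc i)) m = select (3 ℕ.+ i ≤ᵇ k) refl
  where
  s = signPow (3 ℕ.+ i)
  c = k C (3 ℕ.+ i)
  Y = mulP (powP oneMinusY (half (3 ℕ.+ i))) (U i)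
  select : ∀ b → (3 ℕ.+ i ≤ᵇ k) ≡ b → (if b then scaleP (- (s * + c)) Y else zeroP) m ≡ - + c * (s * Y m)
  select true  _ = rearrange s (+ c) (Y m)
    where
    rearrange : ∀ s c y → - (s * c) * y ≡ - c * (s * y)
    rearrange = solve-∀
  select false 3+i≰ᵇk = cong (λ t → - + t * (s * Y m)) (sym c≡0)
    where
    c≡0 : c ≡ 0
    c≡0 = k>n⇒nCk≡0 {k} {3 ℕ.+ i} (ℕₚ.≰⇒> (λ 3+i≤k → subst T 3+i≰ᵇk (ℕₚ.≤⇒≤ᵇ 3+i≤k)))

F123-denom : ∀ k n m → mul2 (F123 k) (denom k) n m ≡ one2 n m
F123-denom k zero    m = trans (mulP-identityʳ (F123 k 0) m) (F123-empty m)
  where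
  F123-empty : F123 k 0 ≗ oneP
  F123-empty zero    = refl
  F123-empty (suc m) = refl
F123-denom k (suc n) m = begin
  mul2 (F123 k) (denom k) (suc n) m
    ≡⟨ mul2-reverse (F123 k) (denom k) (suc n) m ⟩
  sumTo (suc n) (λ j → mulP (F123 k (suc n ∸ j)) (denom k j) m)
    ≡⟨ sumTo-suc n (λ j → mulP (F123 k (suc n ∸ j)) (denom k j) m) ⟩
  mulP (F123 k (suc n)) oneP m + sumTo n (λ i → mulP (F123 k (n ∸ i)) (denom k (suc i)) m)
    ≡⟨ cong₂ _+_ (trans (mulP-identityʳ (F123 k (suc n)) m) (F123≗wordWeight k (suc n) m)) (sumTo-cong n term) ⟩
  wordWeight k (suc n) m + sumTo n (λ i → - (+ (k C suc i) * X i))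
    ≡⟨ cong (λ s → wordWeight k (suc n) m + s) (sumTo-neg n (λ i → + (k C suc i) * X i)) ⟩
  wordWeight k (suc n) m - sumTo n (λ i → + (k C suc i) * X i)
    ≡⟨ cong (λ s → wordWeight k (suc n) m - s) (sym (wordWeight-suc k n m)) ⟩
  wordWeight k (suc n) m - wordWeight k (suc n) m
    ≡⟨ ℤₚ.+-inverseʳ (wordWeight k (suc n) m) ⟩
  + 0 ∎
  where
  X : ℕ → ℤ
  X i = mulP (wordWeight k (n ∸ i)) (blockWeight (suc i)) m
  term : ∀ i → mulP (F123 k (n ∸ i)) (denom k (suc i)) m ≡ - (+ (k C suc i) * X i)
  term i = begin
    mulP (F123 k (n ∸ i)) (denom k (suc i)) m
      ≡⟨ mulP-cong (F123≗wordWeight k (n ∸ i)) (denom-blockWeight k i) m ⟩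
    mulP (wordWeight k (n ∸ i)) (scaleP (- + (k C suc i)) (blockWeight (suc i))) m
      ≡⟨ mulP-scaleʳ (- + (k C suc i)) (wordWeight k (n ∸ i)) (blockWeight (suc i)) m ⟩
    - + (k C suc i) * X i
      ≡⟨ sym (ℤₚ.neg-distribˡ-* (+ (k C suc i)) (X i)) ⟩
    - (+ (k C suc i) * X i) ∎

-- The identity holds for every alphabet size.
theorem3p3 : ((k : ℕ) → 2 ≤ k → (n m : ℕ) → mul2 (F123 k) (denom k) n m ≡ one2 n m)
    × ((n m : ℕ) → mul2 Useries Udenom n m ≡ Unum n m)
theorem3p3 = (λ k _ → F123-denom k) , Useries-Udenom
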